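{- Let $D\in\overline{\mathbf D}$ be a coherent SDT and $F$ a finitely coherent and complete SDFS. Then (i) the SDFS $F_D$ is finitely coherent, conjunctive and complete; (ii) $F=F_{D_F}$, so $F$ is conjunctive. Hence, if the closure operator $\mathrm{cl}$ is finitary, a finitely coherent SDFS is complete if and only if it is conjunctive, and the set of all complete finitely coherent SDFSes equals $\{F_D:D\in\overline{\mathbf D}\}$.
   Context: Let $\mathcal T$ be a non-empty set (of "things"). Let $\mathrm{cl}:\mathcal P(\mathcal T)\to\mathcal P(\mathcal T)$ be a closure operator (extensive, monotone, idempotent); it is finitary if $\mathrm{cl}(A)=\bigcup\{\mathrm{cl}(G):G\subseteq A,\ G\text{ finite}\}$ for all $A\subseteq\mathcal T$. Let $\mathcal T_-\subseteq\mathcal T$ be a set of forbidden things and $\mathcal T_+:=\mathrm{cl}(\emptyset)$, with standing assumption $\mathcal T_+\cap\mathcal T_-=\emptyset$. A coherent SDT is a $D\subseteq\mathcal T$ with $\mathrm{cl}(D)=D$ and $D\cap\mathcal T_-=\emptyset$; $\overline{\mathbf D}$ is the set of all coherent SDTs. $\mathcal Q(\mathcal T)$ is the set of finite subsets of $\mathcal T$ (including $\emptyset$). For $\mathcal V\subseteq\mathcal Q(\mathcal T)$, $\Sigma_{\mathcal V}$ is the set of maps $\sigma:\mathcal V\to\mathcal T$ with $\sigma(A)\in A$ for all $A\in\mathcal V$, and $\sigma(\mathcal V):=\{\sigma(A):A\in\mathcal V\}$. An SDFS is any $F\subseteq\mathcal Q(\mathcal T)$. It is finitely coherent if (F1) $\emptyset\notin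 F$; (F2) if $A_1\in F$ and $A_1\subseteq A_2\in\mathcal Q(\mathcal T)$ then $A_2\in F$; (F3) if $A\in F$ then $A\setminus\mathcal T_-\in F$; (F4) $\{t\}\in F$ for all $t\in\mathcal T_+$; (F5) for every non-empty finite $\mathcal V\subseteq F$ and every family $(t_\sigma)_{\sigma\in\Sigma_{\mathcal V}}$ with $t_\sigma\in\mathrm{cl}(\sigma(\mathcal V))$, $\{t_\sigma:\sigma\in\Sigma_{\mathcal V}\}\in F$. An SDFS $F$ is conjunctive if for all $A\in F$ there is $t\in A$ with $\{t\}\in F$; complete if for all finite $A_1,A_2\subseteq\mathcal T$, $A_1\cup A_2\in F$ implies $A_1\in F$ or $A_2\in F$. For $D\subseteq\mathcal T$ let $F_D:=\{A\in\mathcal Q(\mathcal T):A\cap D\neq\emptyset\}$; for an SDFS $F$ let $D_F:=\{t\in\mathcal T:\{t\}\in F\}$. -}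

module Defs where

open import Level using (0ℓ)
open import Data.Empty using (⊥)
open import Data.Product using (Σ; ∃; _×_; _,_)
open import Data.Sum using (_⊎_)
open import Data.List using (List; []; _∷_; _++_; map; concatMap; [_])
open import Data.List.Membership.Propositional using (_∈_)
open import Data.List.Relation.Binary.Pointwise using (Pointwise)
open import Relation.Nullary using (¬_)
open import Relation.Unary using (Pred; _⊆_; _≐_; ∅)
open import Function.Bundles using (_⇔_)

-- Subsets of the set of things T are predicates T → Set.
-- A finite subset of T (an element of Q(T)) is represented by a list;
-- the subset it denotes is the set of its members.
⟦_⟧ : {T : Set} → List T → Pred T 0ℓ
⟦ A ⟧ t = t ∈ A

record IsClosureOperator {T : Set} (cl : Pred T 0ℓ → Pred T 0ℓ) : Set₁ where
  field
    extensive  : ∀ A → A ⊆ cl A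
    monotone   : ∀ {A B} → A ⊆ B → cl A ⊆ cl B
    idempotent : ∀ A → cl (cl A) ≐ cl A

Finitary : {T : Set} → (Pred T 0ℓ → Pred T 0ℓ) → Set₁
Finitary {T} cl = ∀ (A : Pred T 0ℓ) →
  cl A ≐ (λ t → Σ (List T) λ G → (⟦ G ⟧ ⊆ A) × cl ⟦ G ⟧ t)

Coherent : {T : Set} → (Pred T 0ℓ → Pred T 0ℓ) → Pred T 0ℓ → Pred T 0ℓ → Set
Coherent cl T₋ D = (cl D ≐ D) × (∀ t → D t → T₋ t → ⊥)

SDFS : Set → Set₁
SDFS T = List T → Set

-- All choice functions σ on V = [A₁,…,Aₙ], each listed by its image
-- [σ(A₁),…,σ(Aₙ)] (cartesian product A₁ × ⋯ × Aₙ).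
choices : {T : Set} → List (List T) → List (List T)
choices []      = [ [] ]
choices (A ∷ V) = concatMap (λ a → map (a ∷_) (choices V)) A

record FinitelyCoherent {T : Set} (cl : Pred T 0ℓ → Pred T 0ℓ) (T₋ : Pred T 0ℓ)
                        (F : SDFS T) : Set where
  field
    F1 : ¬ F []
    F2 : ∀ A₁ A₂ → F A₁ → ⟦ A₁ ⟧ ⊆ ⟦ A₂ ⟧ → F A₂
    F3 : ∀ A → F A → ∀ B → (∀ t → (t ∈ B) ⇔ ((t ∈ A) × ¬ T₋ t)) → F B
    F4 : ∀ t → cl ∅ t → F [ t ]
    -- V non-empty finite subset of F; ts lists the family (t_σ)_σ, one
    -- entry per choice function σ, with t_σ ∈ cl(σ(V)).
    F5 : ∀ (A : List T) (V : List (List T)) →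
         F A → (∀ B → B ∈ V → F B) →
         ∀ (ts : List T) →
         Pointwise (λ σV t → cl ⟦ σV ⟧ t) (choices (A ∷ V)) ts →
         F ts

Conjunctive : {T : Set} → SDFS T → Set
Conjunctive {T} F = ∀ A → F A → Σ T λ t → (t ∈ A) × F [ t ]

Complete : {T : Set} → SDFS T → Set
Complete {T} F = ∀ (A₁ A₂ : List T) → F (A₁ ++ A₂) → F A₁ ⊎ F A₂

F[_] : {T : Set} → Pred T 0ℓ → SDFS T
F[ D ] A = Σ _ λ t → (t ∈ A) × D t

D[_] : {T : Set} → SDFS T → Pred T 0ℓ
D[ F ] t = F [ t ]

_≡F_ : {T : Set} → SDFS T → SDFS T → Set
F ≡F G = ∀ A → F A ⇔ G A

{-# OPTIONS --safe #-}
-- A complete SDFS F not containing ∅ is determined by its singletons: peeling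
-- one element off A ∈ F at a time, completeness yields some t ∈ A with {t} ∈ F,
-- so F = F_{D_F}; conversely F_D is complete and conjunctive by construction.
-- F_D inherits (F1)–(F5) from the coherence of D: in (F5) every set of V meets D,
-- so some choice σ(V) lies inside D and then t_σ ∈ cl(σ(V)) ⊆ cl(D) = D.
-- For finitary cl, D_F is closed because every t ∈ cl(D_F) lies in cl(G) for a
-- finite G ⊆ D_F, and (F5) applied to the singletons of G puts {t} in F.
module Submission where

open import Defs
open import Level using (0ℓ)
open import Data.Empty using (⊥; ⊥-elim)
open import Data.Product using (Σ; _×_; _,_; proj₁)
open import Data.Sum using (inj₁; inj₂; [_,_]′)
open import Data.List using (List; []; _∷_; _++_; map; [_])
open import Data.List.Membership.Propositional using (_∈_)
open import Data.List.Membership.Propositional.Properties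
  using (∈-++⁻; ∈-map⁺; ∈-map⁻; ∈-concatMap⁺)
import Data.List.Relation.Unary.Any as Any
open import Data.List.Relation.Unary.Any using (here; there)
open import Data.List.Relation.Binary.Pointwise using (Pointwise; []; _∷_)
open import Relation.Nullary using (¬_)
open import Relation.Unary using (Pred; ∅; _⊆_; _≐_)
open import Relation.Binary.PropositionalEquality using (_≡_; refl; subst; sym)
open import Function using (_∘_)
open import Function.Bundles using (_⇔_; mk⇔; Equivalence)

module _ {T : Set} where

  Pointwise-∈ : ∀ {R : List T → T → Set} {xs ys} → Pointwise R xs ys →
                ∀ {x} → x ∈ xs → Σ T λ y → (y ∈ ys) × R x y
  Pointwise-∈ (r ∷ _)  (here refl) = _ , here refl , r
  Pointwise-∈ (_ ∷ rs) (there x∈xs) with Pointwise-∈ rs x∈xs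
  ... | y , y∈ys , r = y , there y∈ys , r

  ∷-∈-choices : ∀ {a : T} {c A} {V : List (List T)} →
                a ∈ A → c ∈ choices V → (a ∷ c) ∈ choices (A ∷ V)
  ∷-∈-choices {V = V} a∈A c∈ =
    ∈-concatMap⁺ (λ a → map (a ∷_) (choices V)) (Any.map (λ { refl → ∈-map⁺ _ c∈ }) a∈A)

  choice-⊆ : (D : Pred T 0ℓ) (V : List (List T)) →
             (∀ B → B ∈ V → F[ D ] B) →
             Σ (List T) λ c → (c ∈ choices V) × (⟦ c ⟧ ⊆ D)
  choice-⊆ D []      _    = [] , here refl , λ ()
  choice-⊆ D (A ∷ V) meet with meet A (here refl) | choice-⊆ D V (λ B → meet B ∘ there)
  ... | a , a∈A , Da | c , c∈ , c⊆D =
    a ∷ c , ∷-∈-choices {V = V} a∈A c∈ , λ { (here refl) → Da ; (there x∈c) → c⊆D x∈c }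

  choices-singletons : (G : List T) → choices (map [_] G) ≡ [ G ]
  choices-singletons []      = refl
  choices-singletons (g ∷ G) rewrite choices-singletons G = refl

  F[]-conjunctive : (D : Pred T 0ℓ) → Conjunctive F[ D ]
  F[]-conjunctive D A (t , t∈A , Dt) = t , t∈A , (t , here refl , Dt)

  F[]-complete : (D : Pred T 0ℓ) → Complete F[ D ]
  F[]-complete D A₁ A₂ (t , t∈A₁++A₂ , Dt) with ∈-++⁻ A₁ t∈A₁++A₂
  ... | inj₁ t∈A₁ = inj₁ (t , t∈A₁ , Dt)
  ... | inj₂ t∈A₂ = inj₂ (t , t∈A₂ , Dt)

  complete⇒conjunctive : ∀ {F : SDFS T} → ¬ F [] → Complete F → Conjunctive F
  complete⇒conjunctive ∅∉F complete []      F∅ = ⊥-elim (∅∉F F∅)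
  complete⇒conjunctive ∅∉F complete (a ∷ A) FaA with complete [ a ] A FaA
  ... | inj₁ Fa = a , here refl , Fa
  ... | inj₂ FA with complete⇒conjunctive ∅∉F complete A FA
  ... | t , t∈A , Ft = t , there t∈A , Ft

  ≡F-complete : ∀ {F G : SDFS T} → F ≡F G → Complete G → Complete F
  ≡F-complete {F} {G} F≡G complete A₁ A₂ FA₁++A₂ =
    [ inj₁ ∘ from , inj₂ ∘ from ]′ (complete A₁ A₂ (Equivalence.to (F≡G (A₁ ++ A₂)) FA₁++A₂))
    where
    from : ∀ {A} → G A → F A
    from {A} = Equivalence.from (F≡G A)

module _ {T : Set} {cl : Pred T 0ℓ → Pred T 0ℓ} {T₋ : Pred T 0ℓ} where

  F[]-finitelyCoherent : IsClosureOperator cl → ∀ {D} → Coherent cl T₋ D →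
                         FinitelyCoherent cl T₋ F[ D ]
  F[]-finitelyCoherent isCl {D} (clD⊆D , D∩T₋=∅) = record
    { F1 = λ { (_ , () , _) }
    ; F2 = λ { _ _ (t , t∈A₁ , Dt) A₁⊆A₂ → t , A₁⊆A₂ t∈A₁ , Dt }
    ; F3 = λ { _ (t , t∈A , Dt) _ B≐A∖T₋ →
               t , Equivalence.from (B≐A∖T₋ t) (t∈A , D∩T₋=∅ t Dt) , Dt }
    ; F4 = λ t t∈cl∅ → t , here refl , proj₁ clD⊆D (monotone (λ ()) t∈cl∅)
    ; F5 = λ A V FA FV ts ts-spec →
        let c , c∈choices , c⊆D =
              choice-⊆ D (A ∷ V) λ { _ (here refl) → FA ; B (there B∈V) → FV B B∈V }
            t , t∈ts , t∈cl-c = Pointwise-∈ ts-spec c∈choices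
        in t , t∈ts , proj₁ clD⊆D (monotone c⊆D t∈cl-c)
    }
    where open IsClosureOperator isCl

  module _ {F : SDFS T} where

    conjunctive⇒F≡F[D[F]] : FinitelyCoherent cl T₋ F → Conjunctive F → F ≡F F[ D[ F ] ]
    conjunctive⇒F≡F[D[F]] fc conjunctive A =
      mk⇔ (conjunctive A) λ { (t , t∈A , Ft) → F2 [ t ] A Ft λ { (here refl) → t∈A } }
      where open FinitelyCoherent fc

    complete⇒F≡F[D[F]] : FinitelyCoherent cl T₋ F → Complete F → F ≡F F[ D[ F ] ]
    complete⇒F≡F[D[F]] fc complete =
      conjunctive⇒F≡F[D[F]] fc (complete⇒conjunctive (FinitelyCoherent.F1 fc) complete)

  module _ {F G : SDFS T} (F≡G : F ≡F G) where

    private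
      to : ∀ {A} → F A → G A
      to {A} = Equivalence.to (F≡G A)
      from : ∀ {A} → G A → F A
      from {A} = Equivalence.from (F≡G A)

    ≡F-finitelyCoherent : FinitelyCoherent cl T₋ G → FinitelyCoherent cl T₋ F
    ≡F-finitelyCoherent fc = record
      { F1 = F1 ∘ to
      ; F2 = λ A₁ A₂ FA₁ A₁⊆A₂ → from (F2 A₁ A₂ (to FA₁) A₁⊆A₂)
      ; F3 = λ A FA B B≐A∖T₋ → from (F3 A (to FA) B B≐A∖T₋)
      ; F4 = λ t t∈cl∅ → from (F4 t t∈cl∅)
      ; F5 = λ A V FA FV ts ts-spec →
               from (F5 A V (to FA) (λ B B∈V → to (FV B B∈V)) ts ts-spec)
      }
      where open FinitelyCoherent fc

  conjunctive⇒complete : ∀ {F} → FinitelyCoherent cl T₋ F → Conjunctive F → Complete F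
  conjunctive⇒complete {F} fc conjunctive =
    ≡F-complete (conjunctive⇒F≡F[D[F]] fc conjunctive) (F[]-complete D[ F ])

  module _ (isCl : IsClosureOperator cl) {F : SDFS T} (fc : FinitelyCoherent cl T₋ F) where

    open IsClosureOperator isCl
    open FinitelyCoherent fc

    D[]-closed : Finitary cl → cl D[ F ] ≐ D[ F ]
    D[]-closed finitary = cl⊆ , extensive D[ F ]
      where
      cl⊆ : cl D[ F ] ⊆ D[ F ]
      cl⊆ {t} t∈cl with proj₁ (finitary D[ F ]) t∈cl
      ... | []    , _    , t∈cl∅ = F4 t (monotone (λ ()) t∈cl∅)
      ... | g ∷ G , G⊆DF , t∈clG =
        F5 [ g ] (map [_] G) (G⊆DF (here refl)) singletons∈F [ t ]
           (subst (λ σs → Pointwise (λ σV t → cl ⟦ σV ⟧ t) σs [ t ])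
                  (sym (choices-singletons (g ∷ G))) (t∈clG ∷ []))
        where
        singletons∈F : ∀ B → B ∈ map [_] G → F B
        singletons∈F B B∈ with ∈-map⁻ [_] B∈
        ... | x , x∈G , refl = G⊆DF (there x∈G)

    D[]-disjoint : ∀ t → D[ F ] t → T₋ t → ⊥
    D[]-disjoint t Ft t∈T₋ =
      F1 (F3 [ t ] Ft [] λ _ → mk⇔ (λ ()) λ { (here refl , t∉T₋) → ⊥-elim (t∉T₋ t∈T₋) })

proposition22 :
    (T : Set) → T →
    (cl : Pred T 0ℓ → Pred T 0ℓ) → IsClosureOperator cl →
    (T₋ : Pred T 0ℓ) → (∀ t → cl ∅ t → T₋ t → ⊥) →
    -- (i)
    (∀ (D : Pred T 0ℓ) → Coherent cl T₋ D →
       FinitelyCoherent cl T₋ F[ D ] × Conjunctive F[ D ] × Complete F[ D ])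
    -- (ii)
    × (∀ (F : SDFS T) → FinitelyCoherent cl T₋ F → Complete F →
       (F ≡F F[ D[ F ] ]) × Conjunctive F)
    -- consequences for finitary cl
    × (Finitary cl →
       (∀ (F : SDFS T) → FinitelyCoherent cl T₋ F → (Complete F ⇔ Conjunctive F))
       × (∀ (F : SDFS T) →
            (FinitelyCoherent cl T₋ F × Complete F)
            ⇔ Σ (Pred T 0ℓ) (λ D → Coherent cl T₋ D × (F ≡F F[ D ]))))
proposition22 T _ cl isCl T₋ _ =
    (λ D coherent → F[]-finitelyCoherent isCl coherent , F[]-conjunctive D , F[]-complete D)
  , (λ F fc complete →
       complete⇒F≡F[D[F]] fc complete , complete⇒conjunctive (FinitelyCoherent.F1 fc) complete)
  , λ finitary →
      (λ F fc → mk⇔ (complete⇒conjunctive (FinitelyCoherent.F1 fc)) (conjunctive⇒complete fc))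
    , λ F → mk⇔
        (λ (fc , complete) →
           D[ F ] , (D[]-closed isCl fc finitary , D[]-disjoint isCl fc)
                  , complete⇒F≡F[D[F]] fc complete)
        (λ (D , coherent , F≡F[D]) →
           ≡F-finitelyCoherent F≡F[D] (F[]-finitelyCoherent isCl coherent)
         , ≡F-complete F≡F[D] (F[]-complete D))
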